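{- Every typed term is strongly normalizable: if $\Gamma \vdash t : A \, ; \, \Delta$ is derivable, then there is no infinite sequence $(t_i)_{i<\omega}$ with $t_0 = t$ and $t_i \triangleright t_{i+1}$ for all $i$.
   Context: Types are built from propositional variables and the constant $\perp$ with the connectives $\to,\wedge,\vee$. There are two disjoint sets of variables: $\lambda$-variables $x,y,\dots$ and $\mu$-variables $a,b,\dots$. Terms $t$ and $\mathcal{E}$-terms $\varepsilon$ are given by $t ::= x \mid \lambda x.t \mid (t\;\varepsilon) \mid \langle t,t\rangle \mid \omega_1 t \mid \omega_2 t \mid \mu a.t \mid (a\;t)$, $\varepsilon ::= t \mid \pi_1 \mid \pi_2 \mid [x.t,y.t]$ ($\lambda x$, $\mu a$ and the $x.$, $y.$ inside $[x.u,y.v]$ are binders). Typing judgments have the form $\Gamma \vdash t : A\,;\,\Delta$ where $\Gamma$ is a set of declarations $x:A$ and $\Delta$ a set of declarations $a:A$. Rules: (ax) $\Gamma, x:A \vdash x:A\,;\,\Delta$; ($\to_i$) from $\Gamma,x:A\vdash t:B;\Delta$ infer $\Gamma\vdash\lambda x.t:A\to B;\Delta$; ($\to_e$) from $\Gamma\vdash u:A\to B;\Delta$ and $\Gamma\vdash v:A;\Delta$ infer $\Gamma\vdash (u\;v):B;\Delta$; ($\wedge_i$) from $\Gamma\vdash u:A;\Delta$ and $\Gamma\vdash v:B;\Delta$ infer $\Gamma\vdash\langle u,v\rangle:A\wedge B;\Delta$; ($\wedge_e$) from $\Gamma\vdash t:A\wedge B;\Delta$ infer $\Gamma\vdash (t\;\pi_1):A;\Delta$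 and $\Gamma\vdash(t\;\pi_2):B;\Delta$; ($\vee_i$) from $\Gamma\vdash t:A;\Delta$ infer $\Gamma\vdash\omega_1 t:A\vee B;\Delta$, and from $\Gamma\vdash t:B;\Delta$ infer $\Gamma\vdash\omega_2 t:A\vee B;\Delta$; ($\vee_e$) from $\Gamma\vdash t:A\vee B;\Delta$, $\Gamma,x:A\vdash u:C;\Delta$, $\Gamma,y:B\vdash v:C;\Delta$ infer $\Gamma\vdash (t\;[x.u,y.v]):C;\Delta$; ($abs_i$) from $\Gamma\vdash t:A;\Delta,a:A$ infer $\Gamma\vdash (a\;t):\perp;\Delta,a:A$; ($abs_e$) from $\Gamma\vdash t:\perp;\Delta,a:A$ infer $\Gamma\vdash\mu a.t:A;\Delta$. A term is typed if some such judgment is derivable for it. One-step reduction $\triangleright$ is the closure under all contexts of the rules: $(\lambda x.u\;v)\triangleright u[x:=v]$; $(\langle t_1,t_2\rangle\;\pi_i)\triangleright t_i$; $(\omega_i t\;[x_1.u_1,x_2.u_2])\triangleright u_i[x_i:=t]$; $((t\;[x_1.u_1,x_2.u_2])\;\varepsilon)\triangleright (t\;[x_1.(u_1\;\varepsilon),x_2.(u_2\;\varepsilon)])$; $(\mu a.t\;\varepsilon)\triangleright \mu a.t[a:=^*\varepsilon]$, where $t[a:=^*\varepsilon]$ is obtained from $t$ by replacing inductively each subterm of the form $(a\;v)$ by $(a\;(v\;\varepsilon))$. -}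

module Defs where

open import Data.Nat using (ℕ; zero; suc; _≟_)
open import Data.List using (List; _∷_)
open import Relation.Nullary using (yes; no)

data Ty : Set where
  atom : ℕ → Ty
  ⊥'   : Ty
  _⇒_  : Ty → Ty → Ty
  _∧'_ : Ty → Ty → Ty
  _∨'_ : Ty → Ty → Ty

-- Terms and E-terms, locally nameless via de Bruijn indices.
-- λ-variables and μ-variables are two separate index spaces.
mutual
  data Term : Set where
    var  : ℕ → Term
    lam  : Term → Term
    app  : Term → ETerm → Term
    pair : Term → Term → Term
    ω₁   : Term → Term
    ω₂   : Term → Term
    mu   : Term → Term             -- μ a . t   (binds μ-index 0)
    nm   : ℕ → Term → Term         -- (a t)     for μ-variable a

  data ETerm : Set where
    tm   : Term → ETerm
    π₁   : ETerm
    π₂   : ETerm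
    case : Term → Term → ETerm     -- [x.u , y.v]  (each branch binds λ-index 0)

ext : (ℕ → ℕ) → ℕ → ℕ
ext ρ zero    = zero
ext ρ (suc n) = suc (ρ n)

mutual
  ren : (ℕ → ℕ) → (ℕ → ℕ) → Term → Term
  ren ρ σ (var x)    = var (ρ x)
  ren ρ σ (lam t)    = lam (ren (ext ρ) σ t)
  ren ρ σ (app t e)  = app (ren ρ σ t) (renE ρ σ e)
  ren ρ σ (pair t u) = pair (ren ρ σ t) (ren ρ σ u)
  ren ρ σ (ω₁ t)     = ω₁ (ren ρ σ t)
  ren ρ σ (ω₂ t)     = ω₂ (ren ρ σ t)
  ren ρ σ (mu t)     = mu (ren ρ (ext σ) t)
  ren ρ σ (nm a t)   = nm (σ a) (ren ρ σ t)

  renE : (ℕ → ℕ) → (ℕ → ℕ) → ETerm → ETerm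
  renE ρ σ (tm t)     = tm (ren ρ σ t)
  renE ρ σ π₁         = π₁
  renE ρ σ π₂         = π₂
  renE ρ σ (case u v) = case (ren (ext ρ) σ u) (ren (ext ρ) σ v)

idR : ℕ → ℕ
idR n = n

wkλ : Term → Term
wkλ = ren suc idR

wkλE : ETerm → ETerm
wkλE = renE suc idR

wkμ : Term → Term
wkμ = ren idR suc

wkμE : ETerm → ETerm
wkμE = renE idR suc

exts : (ℕ → Term) → ℕ → Term
exts s zero    = var zero
exts s (suc n) = wkλ (s n)

mutual
  sub : (ℕ → Term) → Term → Term
  sub s (var x)    = s x
  sub s (lam t)    = lam (sub (exts s) t)
  sub s (app t e)  = app (sub s t) (subE s e)
  sub s (pair t u) = pair (sub s t) (sub s u)
  sub s (ω₁ t)     = ω₁ (sub s t)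
  sub s (ω₂ t)     = ω₂ (sub s t)
  sub s (mu t)     = mu (sub (λ n → wkμ (s n)) t)
  sub s (nm a t)   = nm a (sub s t)

  subE : (ℕ → Term) → ETerm → ETerm
  subE s (tm t)     = tm (sub s t)
  subE s π₁         = π₁
  subE s π₂         = π₂
  subE s (case u v) = case (sub (exts s) u) (sub (exts s) v)

single : Term → ℕ → Term
single v zero    = v
single v (suc n) = var n

_[0≔_] : Term → Term → Term
u [0≔ v ] = sub (single v) u

-- structural substitution t [ a :=* ε ]: every subterm (a v) becomes (a (v ε));
-- a is the μ-index k (shifted when crossing μ-binders)
mutual
  msub : ℕ → ETerm → Term → Term
  msub k e (var x)    = var x
  msub k e (lam t)    = lam (msub k (wkλE e) t)
  msub k e (app t f)  = app (msub k e t) (msubE k e f)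
  msub k e (pair t u) = pair (msub k e t) (msub k e u)
  msub k e (ω₁ t)     = ω₁ (msub k e t)
  msub k e (ω₂ t)     = ω₂ (msub k e t)
  msub k e (mu t)     = mu (msub (suc k) (wkμE e) t)
  msub k e (nm a t) with a ≟ k
  ... | yes _ = nm a (app (msub k e t) e)
  ... | no  _ = nm a (msub k e t)

  msubE : ℕ → ETerm → ETerm → ETerm
  msubE k e (tm t)     = tm (msub k e t)
  msubE k e π₁         = π₁
  msubE k e π₂         = π₂
  msubE k e (case u v) = case (msub k (wkλE e) u) (msub k (wkλE e) v)

mutual
  infix 4 _▷_ _▷E_
  data _▷_ : Term → Term → Set where
    β       : ∀ {u v} → app (lam u) (tm v) ▷ u [0≔ v ]
    β∧₁     : ∀ {t₁ t₂} → app (pair t₁ t₂) π₁ ▷ t₁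
    β∧₂     : ∀ {t₁ t₂} → app (pair t₁ t₂) π₂ ▷ t₂
    β∨₁     : ∀ {t u₁ u₂} → app (ω₁ t) (case u₁ u₂) ▷ u₁ [0≔ t ]
    β∨₂     : ∀ {t u₁ u₂} → app (ω₂ t) (case u₁ u₂) ▷ u₂ [0≔ t ]
    perm    : ∀ {t u₁ u₂ e} →
              app (app t (case u₁ u₂)) e ▷ app t (case (app u₁ (wkλE e)) (app u₂ (wkλE e)))
    μβ      : ∀ {t e} → app (mu t) e ▷ mu (msub zero (wkμE e) t)
    c-lam   : ∀ {t t'} → t ▷ t' → lam t ▷ lam t'
    c-appl  : ∀ {t t' e} → t ▷ t' → app t e ▷ app t' e
    c-appr  : ∀ {t e e'} → e ▷E e' → app t e ▷ app t e'
    c-pairl : ∀ {t t' u} → t ▷ t' → pair t u ▷ pair t' u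
    c-pairr : ∀ {t u u'} → u ▷ u' → pair t u ▷ pair t u'
    c-ω₁    : ∀ {t t'} → t ▷ t' → ω₁ t ▷ ω₁ t'
    c-ω₂    : ∀ {t t'} → t ▷ t' → ω₂ t ▷ ω₂ t'
    c-mu    : ∀ {t t'} → t ▷ t' → mu t ▷ mu t'
    c-nm    : ∀ {a t t'} → t ▷ t' → nm a t ▷ nm a t'

  data _▷E_ : ETerm → ETerm → Set where
    c-tm    : ∀ {t t'} → t ▷ t' → tm t ▷E tm t'
    c-casel : ∀ {u u' v} → u ▷ u' → case u v ▷E case u' v
    c-caser : ∀ {u v v'} → v ▷ v' → case u v ▷E case u v'

-- contexts: de Bruijn lists of types (index 0 = most recent declaration)
Ctx : Set
Ctx = List Ty

infix 4 _∋_⦂_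
data _∋_⦂_ : Ctx → ℕ → Ty → Set where
  here  : ∀ {Γ A} → (A ∷ Γ) ∋ zero ⦂ A
  there : ∀ {Γ n A B} → Γ ∋ n ⦂ A → (B ∷ Γ) ∋ suc n ⦂ A

infix 3 _⊢_⦂_⨾_
data _⊢_⦂_⨾_ : Ctx → Term → Ty → Ctx → Set where
  ax    : ∀ {Γ Δ x A} → Γ ∋ x ⦂ A → Γ ⊢ var x ⦂ A ⨾ Δ
  →i    : ∀ {Γ Δ t A B} → (A ∷ Γ) ⊢ t ⦂ B ⨾ Δ → Γ ⊢ lam t ⦂ A ⇒ B ⨾ Δ
  →e    : ∀ {Γ Δ u v A B} → Γ ⊢ u ⦂ A ⇒ B ⨾ Δ → Γ ⊢ v ⦂ A ⨾ Δ → Γ ⊢ app u (tm v) ⦂ B ⨾ Δ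
  ∧i    : ∀ {Γ Δ u v A B} → Γ ⊢ u ⦂ A ⨾ Δ → Γ ⊢ v ⦂ B ⨾ Δ → Γ ⊢ pair u v ⦂ A ∧' B ⨾ Δ
  ∧e₁   : ∀ {Γ Δ t A B} → Γ ⊢ t ⦂ A ∧' B ⨾ Δ → Γ ⊢ app t π₁ ⦂ A ⨾ Δ
  ∧e₂   : ∀ {Γ Δ t A B} → Γ ⊢ t ⦂ A ∧' B ⨾ Δ → Γ ⊢ app t π₂ ⦂ B ⨾ Δ
  ∨i₁   : ∀ {Γ Δ t A B} → Γ ⊢ t ⦂ A ⨾ Δ → Γ ⊢ ω₁ t ⦂ A ∨' B ⨾ Δ
  ∨i₂   : ∀ {Γ Δ t A B} → Γ ⊢ t ⦂ B ⨾ Δ → Γ ⊢ ω₂ t ⦂ A ∨' B ⨾ Δ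
  ∨e    : ∀ {Γ Δ t u v A B C} → Γ ⊢ t ⦂ A ∨' B ⨾ Δ → (A ∷ Γ) ⊢ u ⦂ C ⨾ Δ →
          (B ∷ Γ) ⊢ v ⦂ C ⨾ Δ → Γ ⊢ app t (case u v) ⦂ C ⨾ Δ
  absi  : ∀ {Γ Δ a t A} → Δ ∋ a ⦂ A → Γ ⊢ t ⦂ A ⨾ Δ → Γ ⊢ nm a t ⦂ ⊥' ⨾ Δ
  abse  : ∀ {Γ Δ t A} → Γ ⊢ t ⦂ ⊥' ⨾ (A ∷ Δ) → Γ ⊢ mu t ⦂ A ⨾ Δ

-- Reducibility by orthogonality to stacks of eliminations (arguments, projections, case
-- branches). Reducible stacks are defined by induction on the type: a reducible argument followed
-- by a B-stack for A ⇒ B, a projection followed by a stack of the chosen component for ∧, two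
-- branches that stay strongly normalising on reducible inputs for ∨, the empty stack for atoms
-- and ⊥. A term is reducible when, under every renaming, it is strongly normalising in front of
-- every reducible stack. Reducible terms are SN because every type has a reducible stack made of
-- variables, and the introduction rules are handled by expansion lemmas. The μ-rule hands the
-- whole stack S faced by μ a.t to every (a v) in t, so a simultaneous substitution that also
-- appends stacks to named terms turns adequacy into an induction on derivations.

module Submission where

open import Defs
open import Data.Nat using (ℕ; zero; suc; _≟_; _≤_; s≤s)
open import Data.Nat.Properties using (≤-refl; ≤-trans; n≤1+n; suc-injective)
open import Data.List using (List; []; _∷_; map; _++_; foldl; length)
open import Data.List.Properties using (map-++; map-∘; map-cong; map-id; ++-identityʳ; foldl-++)
open import Data.Product using (Σ; ∃-syntax; _×_; _,_)
open import Data.Sum using (_⊎_; inj₁; inj₂)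
open import Data.Empty using (⊥-elim)
open import Function using (_∘_; flip)
open import Induction.WellFounded using (Acc; acc)
open import Induction.InfiniteDescent
  using (InfiniteDescendingSequenceFrom; descent∧acc⇒unsatisfiable)
open import Relation.Binary.Construct.Closure.ReflexiveTransitive using (Star; ε; _◅_; _◅◅_; gmap)
open import Relation.Binary.PropositionalEquality
  using (_≡_; _≗_; refl; sym; trans; cong; cong₂; subst; subst₂; respʳ; module ≡-Reasoning)
open import Relation.Nullary using (¬_; yes; no; Dec)

-- Stacks and renamings

Stack : Set
Stack = List ETerm

plug : Term → Stack → Term
plug = foldl app

renS : (ℕ → ℕ) → (ℕ → ℕ) → Stack → Stack
renS ρ σ = map (renE ρ σ)

wkλS : Stack → Stack
wkλS = renS suc idR

wkμS : Stack → Stack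
wkμS = renS idR suc

≗-refl : {A B : Set} {f : A → B} → f ≗ f
≗-refl _ = refl

private
  variable
    ρ ρ' ρ'' σ σ' σ'' ν ν' ν₁ ν₂ : ℕ → ℕ
    s s' s₁ s₂ : ℕ → Term
    κ κ' κ₁ κ₂ : ℕ → Stack

ext-∘ : ρ ∘ ρ' ≗ ρ'' → ext ρ ∘ ext ρ' ≗ ext ρ''
ext-∘ h zero    = refl
ext-∘ h (suc n) = cong suc (h n)

ext-id : ρ ≗ idR → ext ρ ≗ idR
ext-id h zero    = refl
ext-id h (suc n) = cong suc (h n)

mutual
  ren-∘ : ρ ∘ ρ' ≗ ρ'' → σ ∘ σ' ≗ σ'' →
          ∀ t → ren ρ σ (ren ρ' σ' t) ≡ ren ρ'' σ'' t
  ren-∘ hρ hσ (var x)    = cong var (hρ x)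
  ren-∘ hρ hσ (lam t)    = cong lam (ren-∘ (ext-∘ hρ) hσ t)
  ren-∘ hρ hσ (app t e)  = cong₂ app (ren-∘ hρ hσ t) (renE-∘ hρ hσ e)
  ren-∘ hρ hσ (pair t u) = cong₂ pair (ren-∘ hρ hσ t) (ren-∘ hρ hσ u)
  ren-∘ hρ hσ (ω₁ t)     = cong ω₁ (ren-∘ hρ hσ t)
  ren-∘ hρ hσ (ω₂ t)     = cong ω₂ (ren-∘ hρ hσ t)
  ren-∘ hρ hσ (mu t)     = cong mu (ren-∘ hρ (ext-∘ hσ) t)
  ren-∘ hρ hσ (nm a t)   = cong₂ nm (hσ a) (ren-∘ hρ hσ t)

  renE-∘ : ρ ∘ ρ' ≗ ρ'' → σ ∘ σ' ≗ σ'' →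
           ∀ e → renE ρ σ (renE ρ' σ' e) ≡ renE ρ'' σ'' e
  renE-∘ hρ hσ (tm t)     = cong tm (ren-∘ hρ hσ t)
  renE-∘ hρ hσ π₁         = refl
  renE-∘ hρ hσ π₂         = refl
  renE-∘ hρ hσ (case u v) = cong₂ case (ren-∘ (ext-∘ hρ) hσ u) (ren-∘ (ext-∘ hρ) hσ v)

mutual
  ren-id : ρ ≗ idR → σ ≗ idR → ∀ t → ren ρ σ t ≡ t
  ren-id hρ hσ (var x)    = cong var (hρ x)
  ren-id hρ hσ (lam t)    = cong lam (ren-id (ext-id hρ) hσ t)
  ren-id hρ hσ (app t e)  = cong₂ app (ren-id hρ hσ t) (renE-id hρ hσ e)
  ren-id hρ hσ (pair t u) = cong₂ pair (ren-id hρ hσ t) (ren-id hρ hσ u)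
  ren-id hρ hσ (ω₁ t)     = cong ω₁ (ren-id hρ hσ t)
  ren-id hρ hσ (ω₂ t)     = cong ω₂ (ren-id hρ hσ t)
  ren-id hρ hσ (mu t)     = cong mu (ren-id hρ (ext-id hσ) t)
  ren-id hρ hσ (nm a t)   = cong₂ nm (hσ a) (ren-id hρ hσ t)

  renE-id : ρ ≗ idR → σ ≗ idR → ∀ e → renE ρ σ e ≡ e
  renE-id hρ hσ (tm t)     = cong tm (ren-id hρ hσ t)
  renE-id hρ hσ π₁         = refl
  renE-id hρ hσ π₂         = refl
  renE-id hρ hσ (case u v) = cong₂ case (ren-id (ext-id hρ) hσ u) (ren-id (ext-id hρ) hσ v)

ren-wkλ : ∀ ρ σ t → ren (ext ρ) σ (wkλ t) ≡ wkλ (ren ρ σ t)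
ren-wkλ ρ σ t = trans (ren-∘ {ρ'' = suc ∘ ρ} {σ'' = σ} ≗-refl ≗-refl t)
                      (sym (ren-∘ ≗-refl ≗-refl t))

renE-wkλ : ∀ ρ σ e → renE (ext ρ) σ (wkλE e) ≡ wkλE (renE ρ σ e)
renE-wkλ ρ σ e = trans (renE-∘ {ρ'' = suc ∘ ρ} {σ'' = σ} ≗-refl ≗-refl e)
                       (sym (renE-∘ ≗-refl ≗-refl e))

ren-wkμ : ∀ ρ σ t → ren ρ (ext σ) (wkμ t) ≡ wkμ (ren ρ σ t)
ren-wkμ ρ σ t = trans (ren-∘ {ρ'' = ρ} {σ'' = suc ∘ σ} ≗-refl ≗-refl t)
                      (sym (ren-∘ ≗-refl ≗-refl t))

renE-wkμ : ∀ ρ σ e → renE ρ (ext σ) (wkμE e) ≡ wkμE (renE ρ σ e)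
renE-wkμ ρ σ e = trans (renE-∘ {ρ'' = ρ} {σ'' = suc ∘ σ} ≗-refl ≗-refl e)
                       (sym (renE-∘ ≗-refl ≗-refl e))

map-commute : ∀ {A B C D : Set} {f : B → D} {g : A → B} {h : C → D} {k : A → C} →
              f ∘ g ≗ h ∘ k → map f ∘ map g ≗ map h ∘ map k
map-commute eq xs =
  trans (sym (map-∘ xs)) (trans (map-cong eq xs) (map-∘ xs))

renS-id : ρ ≗ idR → σ ≗ idR → ∀ S → renS ρ σ S ≡ S
renS-id hρ hσ S = trans (map-cong (renE-id hρ hσ) S) (map-id S)

renS-∘ : ρ ∘ ρ' ≗ ρ'' → σ ∘ σ' ≗ σ'' →
         ∀ S → renS ρ σ (renS ρ' σ' S) ≡ renS ρ'' σ'' S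
renS-∘ hρ hσ S = trans (sym (map-∘ S)) (map-cong (renE-∘ hρ hσ) S)

renS-wkλ : ∀ ρ σ S → renS (ext ρ) σ (wkλS S) ≡ wkλS (renS ρ σ S)
renS-wkλ ρ σ = map-commute (renE-wkλ ρ σ)

renS-wkμ : ∀ ρ σ S → renS ρ (ext σ) (wkμS S) ≡ wkμS (renS ρ σ S)
renS-wkμ ρ σ = map-commute (renE-wkμ ρ σ)

ren-plug : ∀ ρ σ t S → ren ρ σ (plug t S) ≡ plug (ren ρ σ t) (renS ρ σ S)
ren-plug ρ σ t []      = refl
ren-plug ρ σ t (e ∷ S) = ren-plug ρ σ (app t e) S

-- Simultaneous substitution

_▸_ : {A : Set} → A → (ℕ → A) → ℕ → A
(x ▸ f) zero    = x
(x ▸ f) (suc n) = f n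

∅ : ℕ → Stack
∅ _ = []

extκ : (ℕ → Stack) → ℕ → Stack
extκ κ = [] ▸ (wkμS ∘ κ)

-- sb s ν κ substitutes s for the λ-variables, renames the μ-variables by ν and appends the stack
-- κ a to the argument of every (a v). Renaming, substitution and t [a :=* ε] are instances of it.
mutual
  sb : (ℕ → Term) → (ℕ → ℕ) → (ℕ → Stack) → Term → Term
  sb s ν κ (var x)    = s x
  sb s ν κ (lam t)    = lam (sb (exts s) ν (wkλS ∘ κ) t)
  sb s ν κ (app t e)  = app (sb s ν κ t) (sbE s ν κ e)
  sb s ν κ (pair t u) = pair (sb s ν κ t) (sb s ν κ u)
  sb s ν κ (ω₁ t)     = ω₁ (sb s ν κ t)
  sb s ν κ (ω₂ t)     = ω₂ (sb s ν κ t)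
  sb s ν κ (mu t)     = mu (sb (wkμ ∘ s) (ext ν) (extκ κ) t)
  sb s ν κ (nm a t)   = nm (ν a) (plug (sb s ν κ t) (κ a))

  sbE : (ℕ → Term) → (ℕ → ℕ) → (ℕ → Stack) → ETerm → ETerm
  sbE s ν κ (tm t)     = tm (sb s ν κ t)
  sbE s ν κ π₁         = π₁
  sbE s ν κ π₂         = π₂
  sbE s ν κ (case u v) = case (sb (exts s) ν (wkλS ∘ κ) u) (sb (exts s) ν (wkλS ∘ κ) v)

sbS : (ℕ → Term) → (ℕ → ℕ) → (ℕ → Stack) → Stack → Stack
sbS s ν κ = map (sbE s ν κ)

sb-plug : ∀ s ν κ t S → sb s ν κ (plug t S) ≡ plug (sb s ν κ t) (sbS s ν κ S)
sb-plug s ν κ t []      = refl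
sb-plug s ν κ t (e ∷ S) = sb-plug s ν κ (app t e) S

exts-∘ext : s ∘ ρ ≗ s' → exts s ∘ ext ρ ≗ exts s'
exts-∘ext h zero    = refl
exts-∘ext h (suc n) = cong wkλ (h n)

extκ-∘ext : κ ∘ σ ≗ κ' → extκ κ ∘ ext σ ≗ extκ κ'
extκ-∘ext h zero    = refl
extκ-∘ext h (suc a) = cong wkμS (h a)

mutual
  sb∘ren : s ∘ ρ ≗ s' → ν ∘ σ ≗ ν' → κ ∘ σ ≗ κ' →
           ∀ t → sb s ν κ (ren ρ σ t) ≡ sb s' ν' κ' t
  sb∘ren hs hν hκ (var x)    = hs x
  sb∘ren hs hν hκ (lam t)    =
    cong lam (sb∘ren (exts-∘ext hs) hν (λ a → cong wkλS (hκ a)) t)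
  sb∘ren hs hν hκ (app t e)  = cong₂ app (sb∘ren hs hν hκ t) (sbE∘renE hs hν hκ e)
  sb∘ren hs hν hκ (pair t u) = cong₂ pair (sb∘ren hs hν hκ t) (sb∘ren hs hν hκ u)
  sb∘ren hs hν hκ (ω₁ t)     = cong ω₁ (sb∘ren hs hν hκ t)
  sb∘ren hs hν hκ (ω₂ t)     = cong ω₂ (sb∘ren hs hν hκ t)
  sb∘ren hs hν hκ (mu t)     =
    cong mu (sb∘ren (λ n → cong wkμ (hs n)) (ext-∘ hν) (extκ-∘ext hκ) t)
  sb∘ren hs hν hκ (nm a t)   = cong₂ nm (hν a) (cong₂ plug (sb∘ren hs hν hκ t) (hκ a))

  sbE∘renE : s ∘ ρ ≗ s' → ν ∘ σ ≗ ν' → κ ∘ σ ≗ κ' →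
             ∀ e → sbE s ν κ (renE ρ σ e) ≡ sbE s' ν' κ' e
  sbE∘renE hs hν hκ (tm t)     = cong tm (sb∘ren hs hν hκ t)
  sbE∘renE hs hν hκ π₁         = refl
  sbE∘renE hs hν hκ π₂         = refl
  sbE∘renE hs hν hκ (case u v) =
    cong₂ case (sb∘ren (exts-∘ext hs) hν hκλ u) (sb∘ren (exts-∘ext hs) hν hκλ v)
    where hκλ = λ a → cong wkλS (hκ a)

exts-ren∘ : ren ρ σ ∘ s ≗ s' → ren (ext ρ) σ ∘ exts s ≗ exts s'
exts-ren∘ h zero    = refl
exts-ren∘ {ρ = ρ} {σ = σ} {s = s} h (suc n) = trans (ren-wkλ ρ σ (s n)) (cong wkλ (h n))

wkμ-ren∘ : ren ρ σ ∘ s ≗ s' → ren ρ (ext σ) ∘ (wkμ ∘ s) ≗ wkμ ∘ s'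
wkμ-ren∘ {ρ = ρ} {σ = σ} {s = s} h n = trans (ren-wkμ ρ σ (s n)) (cong wkμ (h n))

wkλS-renS∘ : renS ρ σ ∘ κ ≗ κ' → renS (ext ρ) σ ∘ (wkλS ∘ κ) ≗ wkλS ∘ κ'
wkλS-renS∘ {ρ = ρ} {σ = σ} {κ = κ} h a = trans (renS-wkλ ρ σ (κ a)) (cong wkλS (h a))

extκ-renS∘ : renS ρ σ ∘ κ ≗ κ' → renS ρ (ext σ) ∘ extκ κ ≗ extκ κ'
extκ-renS∘ h zero = refl
extκ-renS∘ {ρ = ρ} {σ = σ} {κ = κ} h (suc a) = trans (renS-wkμ ρ σ (κ a)) (cong wkμS (h a))

mutual
  ren∘sb : ren ρ σ ∘ s ≗ s' → σ ∘ ν ≗ ν' → renS ρ σ ∘ κ ≗ κ' →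
           ∀ t → ren ρ σ (sb s ν κ t) ≡ sb s' ν' κ' t
  ren∘sb hs hν hκ (var x)    = hs x
  ren∘sb hs hν hκ (lam t)    = cong lam (ren∘sb (exts-ren∘ hs) hν (wkλS-renS∘ hκ) t)
  ren∘sb hs hν hκ (app t e)  = cong₂ app (ren∘sb hs hν hκ t) (renE∘sbE hs hν hκ e)
  ren∘sb hs hν hκ (pair t u) = cong₂ pair (ren∘sb hs hν hκ t) (ren∘sb hs hν hκ u)
  ren∘sb hs hν hκ (ω₁ t)     = cong ω₁ (ren∘sb hs hν hκ t)
  ren∘sb hs hν hκ (ω₂ t)     = cong ω₂ (ren∘sb hs hν hκ t)
  ren∘sb hs hν hκ (mu t)     =
    cong mu (ren∘sb (wkμ-ren∘ hs) (ext-∘ hν) (extκ-renS∘ hκ) t)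
  ren∘sb {ρ = ρ} {σ = σ} {s = s} {ν = ν} {κ = κ} hs hν hκ (nm a t) =
    cong₂ nm (hν a)
      (trans (ren-plug ρ σ (sb s ν κ t) (κ a)) (cong₂ plug (ren∘sb hs hν hκ t) (hκ a)))

  renE∘sbE : ren ρ σ ∘ s ≗ s' → σ ∘ ν ≗ ν' → renS ρ σ ∘ κ ≗ κ' →
             ∀ e → renE ρ σ (sbE s ν κ e) ≡ sbE s' ν' κ' e
  renE∘sbE hs hν hκ (tm t)     = cong tm (ren∘sb hs hν hκ t)
  renE∘sbE hs hν hκ π₁         = refl
  renE∘sbE hs hν hκ π₂         = refl
  renE∘sbE hs hν hκ (case u v) =
    cong₂ case (ren∘sb (exts-ren∘ hs) hν (wkλS-renS∘ hκ) u)
               (ren∘sb (exts-ren∘ hs) hν (wkλS-renS∘ hκ) v)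

sb-wkλ : ∀ s ν κ t → sb (exts s) ν (wkλS ∘ κ) (wkλ t) ≡ wkλ (sb s ν κ t)
sb-wkλ s ν κ t =
  trans (sb∘ren {s' = wkλ ∘ s} {ν' = ν} {κ' = wkλS ∘ κ} ≗-refl ≗-refl ≗-refl t)
        (sym (ren∘sb ≗-refl ≗-refl ≗-refl t))

sbE-wkλ : ∀ s ν κ e → sbE (exts s) ν (wkλS ∘ κ) (wkλE e) ≡ wkλE (sbE s ν κ e)
sbE-wkλ s ν κ e =
  trans (sbE∘renE {s' = wkλ ∘ s} {ν' = ν} {κ' = wkλS ∘ κ} ≗-refl ≗-refl ≗-refl e)
        (sym (renE∘sbE ≗-refl ≗-refl ≗-refl e))

sb-wkμ : ∀ s ν κ t → sb (wkμ ∘ s) (ext ν) (extκ κ) (wkμ t) ≡ wkμ (sb s ν κ t)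
sb-wkμ s ν κ t =
  trans (sb∘ren {s' = wkμ ∘ s} {ν' = suc ∘ ν} {κ' = wkμS ∘ κ} ≗-refl ≗-refl ≗-refl t)
        (sym (ren∘sb ≗-refl ≗-refl ≗-refl t))

sbE-wkμ : ∀ s ν κ e → sbE (wkμ ∘ s) (ext ν) (extκ κ) (wkμE e) ≡ wkμE (sbE s ν κ e)
sbE-wkμ s ν κ e =
  trans (sbE∘renE {s' = wkμ ∘ s} {ν' = suc ∘ ν} {κ' = wkμS ∘ κ} ≗-refl ≗-refl ≗-refl e)
        (sym (renE∘sbE ≗-refl ≗-refl ≗-refl e))

sbS-wkλ : ∀ s ν κ S → sbS (exts s) ν (wkλS ∘ κ) (wkλS S) ≡ wkλS (sbS s ν κ S)
sbS-wkλ s ν κ = map-commute (sbE-wkλ s ν κ)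

sbS-wkμ : ∀ s ν κ S → sbS (wkμ ∘ s) (ext ν) (extκ κ) (wkμS S) ≡ wkμS (sbS s ν κ S)
sbS-wkμ s ν κ = map-commute (sbE-wkμ s ν κ)

exts-sb∘ : sb s₁ ν₁ κ₁ ∘ s₂ ≗ s →
           sb (exts s₁) ν₁ (wkλS ∘ κ₁) ∘ exts s₂ ≗ exts s
exts-sb∘ h zero = refl
exts-sb∘ {s₁ = s₁} {ν₁ = ν₁} {κ₁ = κ₁} {s₂ = s₂} h (suc n) =
  trans (sb-wkλ s₁ ν₁ κ₁ (s₂ n)) (cong wkλ (h n))

wkμ-sb∘ : ∀ s₁ ν₁ κ₁ (s₂ : ℕ → Term) → sb s₁ ν₁ κ₁ ∘ s₂ ≗ s →
          sb (wkμ ∘ s₁) (ext ν₁) (extκ κ₁) ∘ (wkμ ∘ s₂) ≗ wkμ ∘ s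
wkμ-sb∘ s₁ ν₁ κ₁ s₂ h n = trans (sb-wkμ s₁ ν₁ κ₁ (s₂ n)) (cong wkμ (h n))

wkλS-sbS∘ : ∀ s₁ ν₁ κ₁ (ν₂ : ℕ → ℕ) (κ₂ : ℕ → Stack) →
            (∀ a → sbS s₁ ν₁ κ₁ (κ₂ a) ++ κ₁ (ν₂ a) ≡ κ a) →
            ∀ a → sbS (exts s₁) ν₁ (wkλS ∘ κ₁) (wkλS (κ₂ a)) ++ wkλS (κ₁ (ν₂ a))
                  ≡ wkλS (κ a)
wkλS-sbS∘ s₁ ν₁ κ₁ ν₂ κ₂ h a =
  trans (cong (_++ wkλS (κ₁ (ν₂ a))) (sbS-wkλ s₁ ν₁ κ₁ (κ₂ a)))
        (trans (sym (map-++ (renE suc idR) (sbS s₁ ν₁ κ₁ (κ₂ a)) (κ₁ (ν₂ a))))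
               (cong wkλS (h a)))

extκ-sbS∘ : ∀ s₁ ν₁ κ₁ (ν₂ : ℕ → ℕ) (κ₂ : ℕ → Stack) →
            (∀ a → sbS s₁ ν₁ κ₁ (κ₂ a) ++ κ₁ (ν₂ a) ≡ κ a) →
            ∀ a → sbS (wkμ ∘ s₁) (ext ν₁) (extκ κ₁) (extκ κ₂ a) ++ extκ κ₁ (ext ν₂ a)
                  ≡ extκ κ a
extκ-sbS∘ s₁ ν₁ κ₁ ν₂ κ₂ h zero    = refl
extκ-sbS∘ s₁ ν₁ κ₁ ν₂ κ₂ h (suc a) =
  trans (cong (_++ wkμS (κ₁ (ν₂ a))) (sbS-wkμ s₁ ν₁ κ₁ (κ₂ a)))
        (trans (sym (map-++ (renE idR suc) (sbS s₁ ν₁ κ₁ (κ₂ a)) (κ₁ (ν₂ a))))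
               (cong wkμS (h a)))

mutual
  sb∘sb : sb s₁ ν₁ κ₁ ∘ s₂ ≗ s → ν₁ ∘ ν₂ ≗ ν →
          (∀ a → sbS s₁ ν₁ κ₁ (κ₂ a) ++ κ₁ (ν₂ a) ≡ κ a) →
          ∀ t → sb s₁ ν₁ κ₁ (sb s₂ ν₂ κ₂ t) ≡ sb s ν κ t
  sb∘sb hs hν hκ (var x)    = hs x
  sb∘sb {s₁ = s₁} {ν₁ = ν₁} {κ₁ = κ₁} {ν₂ = ν₂} {κ₂ = κ₂} hs hν hκ (lam t) =
    cong lam (sb∘sb (exts-sb∘ hs) hν (wkλS-sbS∘ s₁ ν₁ κ₁ ν₂ κ₂ hκ) t)
  sb∘sb hs hν hκ (app t e)  = cong₂ app (sb∘sb hs hν hκ t) (sbE∘sbE hs hν hκ e)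
  sb∘sb hs hν hκ (pair t u) = cong₂ pair (sb∘sb hs hν hκ t) (sb∘sb hs hν hκ u)
  sb∘sb hs hν hκ (ω₁ t)     = cong ω₁ (sb∘sb hs hν hκ t)
  sb∘sb hs hν hκ (ω₂ t)     = cong ω₂ (sb∘sb hs hν hκ t)
  sb∘sb {s₁ = s₁} {ν₁ = ν₁} {κ₁ = κ₁} {s₂ = s₂} {ν₂ = ν₂} {κ₂ = κ₂} hs hν hκ (mu t) =
    cong mu (sb∘sb (wkμ-sb∘ s₁ ν₁ κ₁ s₂ hs) (ext-∘ hν) (extκ-sbS∘ s₁ ν₁ κ₁ ν₂ κ₂ hκ) t)
  sb∘sb {s₁ = s₁} {ν₁ = ν₁} {κ₁ = κ₁} {s₂ = s₂} {ν₂ = ν₂} {κ₂ = κ₂} hs hν hκ (nm a t) =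
    cong₂ nm (hν a) (begin
      plug (sb s₁ ν₁ κ₁ (plug (sb s₂ ν₂ κ₂ t) (κ₂ a))) (κ₁ (ν₂ a))
    ≡⟨ cong (flip plug (κ₁ (ν₂ a))) (sb-plug s₁ ν₁ κ₁ (sb s₂ ν₂ κ₂ t) (κ₂ a)) ⟩
      plug (plug (sb s₁ ν₁ κ₁ (sb s₂ ν₂ κ₂ t)) (sbS s₁ ν₁ κ₁ (κ₂ a))) (κ₁ (ν₂ a))
    ≡⟨ sym (foldl-++ app _ (sbS s₁ ν₁ κ₁ (κ₂ a)) (κ₁ (ν₂ a))) ⟩
      plug (sb s₁ ν₁ κ₁ (sb s₂ ν₂ κ₂ t)) (sbS s₁ ν₁ κ₁ (κ₂ a) ++ κ₁ (ν₂ a))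
    ≡⟨ cong₂ plug (sb∘sb hs hν hκ t) (hκ a) ⟩
      _ ∎)
    where open ≡-Reasoning

  sbE∘sbE : sb s₁ ν₁ κ₁ ∘ s₂ ≗ s → ν₁ ∘ ν₂ ≗ ν →
            (∀ a → sbS s₁ ν₁ κ₁ (κ₂ a) ++ κ₁ (ν₂ a) ≡ κ a) →
            ∀ e → sbE s₁ ν₁ κ₁ (sbE s₂ ν₂ κ₂ e) ≡ sbE s ν κ e
  sbE∘sbE hs hν hκ (tm t)     = cong tm (sb∘sb hs hν hκ t)
  sbE∘sbE hs hν hκ π₁         = refl
  sbE∘sbE hs hν hκ π₂         = refl
  sbE∘sbE {s₁ = s₁} {ν₁ = ν₁} {κ₁ = κ₁} {ν₂ = ν₂} {κ₂ = κ₂} hs hν hκ (case u v) =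
    cong₂ case (sb∘sb (exts-sb∘ hs) hν hκλ u) (sb∘sb (exts-sb∘ hs) hν hκλ v)
    where hκλ = wkλS-sbS∘ s₁ ν₁ κ₁ ν₂ κ₂ hκ

ext-cong : ρ ≗ ρ' → ext ρ ≗ ext ρ'
ext-cong h zero    = refl
ext-cong h (suc n) = cong suc (h n)

exts-var : s ≗ var ∘ ρ → exts s ≗ var ∘ ext ρ
exts-var h zero    = refl
exts-var h (suc n) = cong wkλ (h n)

exts-cong : s ≗ s' → exts s ≗ exts s'
exts-cong h zero    = refl
exts-cong h (suc n) = cong wkλ (h n)

exts-id : s ≗ var → exts s ≗ var
exts-id h zero    = refl
exts-id h (suc n) = cong wkλ (h n)

extκ-∅ : κ ≗ ∅ → extκ κ ≗ ∅
extκ-∅ h zero    = refl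
extκ-∅ h (suc a) = cong wkμS (h a)

mutual
  sb≡ren : s ≗ var ∘ ρ → ν ≗ σ → κ ≗ ∅ → ∀ t → sb s ν κ t ≡ ren ρ σ t
  sb≡ren hs hν hκ (var x)    = hs x
  sb≡ren hs hν hκ (lam t)    = cong lam (sb≡ren (exts-var hs) hν (λ a → cong wkλS (hκ a)) t)
  sb≡ren hs hν hκ (app t e)  = cong₂ app (sb≡ren hs hν hκ t) (sbE≡renE hs hν hκ e)
  sb≡ren hs hν hκ (pair t u) = cong₂ pair (sb≡ren hs hν hκ t) (sb≡ren hs hν hκ u)
  sb≡ren hs hν hκ (ω₁ t)     = cong ω₁ (sb≡ren hs hν hκ t)
  sb≡ren hs hν hκ (ω₂ t)     = cong ω₂ (sb≡ren hs hν hκ t)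
  sb≡ren hs hν hκ (mu t)     =
    cong mu (sb≡ren (λ n → cong wkμ (hs n)) (ext-cong hν) (extκ-∅ hκ) t)
  sb≡ren {s = s} {ν = ν} {κ = κ} hs hν hκ (nm a t) =
    cong₂ nm (hν a) (trans (cong (plug (sb s ν κ t)) (hκ a)) (sb≡ren hs hν hκ t))

  sbE≡renE : s ≗ var ∘ ρ → ν ≗ σ → κ ≗ ∅ → ∀ e → sbE s ν κ e ≡ renE ρ σ e
  sbE≡renE hs hν hκ (tm t)     = cong tm (sb≡ren hs hν hκ t)
  sbE≡renE hs hν hκ π₁         = refl
  sbE≡renE hs hν hκ π₂         = refl
  sbE≡renE hs hν hκ (case u v) =
    cong₂ case (sb≡ren (exts-var hs) hν hκλ u) (sb≡ren (exts-var hs) hν hκλ v)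
    where hκλ = λ a → cong wkλS (hκ a)

mutual
  sb≡sub : s ≗ s' → ν ≗ idR → κ ≗ ∅ → ∀ t → sb s ν κ t ≡ sub s' t
  sb≡sub hs hν hκ (var x)    = hs x
  sb≡sub hs hν hκ (lam t)    = cong lam (sb≡sub (exts-cong hs) hν (λ a → cong wkλS (hκ a)) t)
  sb≡sub hs hν hκ (app t e)  = cong₂ app (sb≡sub hs hν hκ t) (sbE≡subE hs hν hκ e)
  sb≡sub hs hν hκ (pair t u) = cong₂ pair (sb≡sub hs hν hκ t) (sb≡sub hs hν hκ u)
  sb≡sub hs hν hκ (ω₁ t)     = cong ω₁ (sb≡sub hs hν hκ t)
  sb≡sub hs hν hκ (ω₂ t)     = cong ω₂ (sb≡sub hs hν hκ t)
  sb≡sub hs hν hκ (mu t)     =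
    cong mu (sb≡sub (λ n → cong wkμ (hs n)) (ext-id hν) (extκ-∅ hκ) t)
  sb≡sub {s = s} {ν = ν} {κ = κ} hs hν hκ (nm a t) =
    cong₂ nm (hν a) (trans (cong (plug (sb s ν κ t)) (hκ a)) (sb≡sub hs hν hκ t))

  sbE≡subE : s ≗ s' → ν ≗ idR → κ ≗ ∅ → ∀ e → sbE s ν κ e ≡ subE s' e
  sbE≡subE hs hν hκ (tm t)     = cong tm (sb≡sub hs hν hκ t)
  sbE≡subE hs hν hκ π₁         = refl
  sbE≡subE hs hν hκ π₂         = refl
  sbE≡subE hs hν hκ (case u v) =
    cong₂ case (sb≡sub (exts-cong hs) hν hκλ u) (sb≡sub (exts-cong hs) hν hκλ v)
    where hκλ = λ a → cong wkλS (hκ a)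

-- Taking the decision itself, rather than its Boolean, lets proofs follow the `with a ≟ k` of msub.
singletonIf : {a k : ℕ} → Dec (a ≡ k) → ETerm → Stack
singletonIf (yes _) e = e ∷ []
singletonIf (no _)  e = []

onlyAt : ℕ → ETerm → ℕ → Stack
onlyAt k e a = singletonIf (a ≟ k) e

renS-singletonIf : ∀ {a k : ℕ} ρ σ (d : Dec (a ≡ k)) e →
                   renS ρ σ (singletonIf d e) ≡ singletonIf d (renE ρ σ e)
renS-singletonIf ρ σ (yes _) e = refl
renS-singletonIf ρ σ (no _)  e = refl

onlyAt-suc : ∀ k e a → onlyAt (suc k) e (suc a) ≡ onlyAt k e a
onlyAt-suc k e a with a ≟ k | suc a ≟ suc k
... | yes _   | yes _     = refl
... | no _    | no _      = refl
... | yes a≡k | no a≢k    = ⊥-elim (a≢k (cong suc a≡k))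
... | no a≢k  | yes a+≡k+ = ⊥-elim (a≢k (suc-injective a+≡k+))

wkλS-onlyAt : ∀ {k e} → κ ≗ onlyAt k e → wkλS ∘ κ ≗ onlyAt k (wkλE e)
wkλS-onlyAt {e = e} hκ a = trans (cong wkλS (hκ a)) (renS-singletonIf suc idR _ e)

extκ-onlyAt : ∀ {k e} → κ ≗ onlyAt k e → extκ κ ≗ onlyAt (suc k) (wkμE e)
extκ-onlyAt hκ zero = refl
extκ-onlyAt {k = k} {e} hκ (suc a) =
  trans (cong wkμS (hκ a)) (trans (renS-singletonIf idR suc _ e) (sym (onlyAt-suc k (wkμE e) a)))

mutual
  sb≡msub : ∀ {k e} → s ≗ var → ν ≗ idR → κ ≗ onlyAt k e →
            ∀ t → sb s ν κ t ≡ msub k e t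
  sb≡msub hs hν hκ (var x)    = hs x
  sb≡msub hs hν hκ (lam t)    = cong lam (sb≡msub (exts-id hs) hν (wkλS-onlyAt hκ) t)
  sb≡msub hs hν hκ (app t f)  = cong₂ app (sb≡msub hs hν hκ t) (sbE≡msubE hs hν hκ f)
  sb≡msub hs hν hκ (pair t u) = cong₂ pair (sb≡msub hs hν hκ t) (sb≡msub hs hν hκ u)
  sb≡msub hs hν hκ (ω₁ t)     = cong ω₁ (sb≡msub hs hν hκ t)
  sb≡msub hs hν hκ (ω₂ t)     = cong ω₂ (sb≡msub hs hν hκ t)
  sb≡msub hs hν hκ (mu t)     =
    cong mu (sb≡msub (λ n → cong wkμ (hs n)) (ext-id hν) (extκ-onlyAt hκ) t)
  sb≡msub {s = s} {ν = ν} {κ = κ} {k} {e} hs hν hκ (nm a t) with a ≟ k | hκ a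
  ... | yes _ | κa≡[e] =
    cong₂ nm (hν a) (trans (cong (plug (sb s ν κ t)) κa≡[e]) (cong (flip app e) (sb≡msub hs hν hκ t)))
  ... | no _  | κa≡[]  =
    cong₂ nm (hν a) (trans (cong (plug (sb s ν κ t)) κa≡[]) (sb≡msub hs hν hκ t))

  sbE≡msubE : ∀ {k e} → s ≗ var → ν ≗ idR → κ ≗ onlyAt k e →
              ∀ f → sbE s ν κ f ≡ msubE k e f
  sbE≡msubE hs hν hκ (tm t)     = cong tm (sb≡msub hs hν hκ t)
  sbE≡msubE hs hν hκ π₁         = refl
  sbE≡msubE hs hν hκ π₂         = refl
  sbE≡msubE hs hν hκ (case u v) =
    cong₂ case (sb≡msub (exts-id hs) hν (wkλS-onlyAt hκ) u)
               (sb≡msub (exts-id hs) hν (wkλS-onlyAt hκ) v)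

sb-id : ∀ t → sb var idR ∅ t ≡ t
sb-id t = trans (sb≡ren {ρ = idR} {σ = idR} ≗-refl ≗-refl ≗-refl t)
                (ren-id ≗-refl ≗-refl t)

sbE-id : ∀ e → sbE var idR ∅ e ≡ e
sbE-id e = trans (sbE≡renE {ρ = idR} {σ = idR} ≗-refl ≗-refl ≗-refl e)
                 (renE-id ≗-refl ≗-refl e)

sub≡sb : ∀ s t → sub s t ≡ sb s idR ∅ t
sub≡sb s t = sym (sb≡sub ≗-refl ≗-refl ≗-refl t)

msub≡sb : ∀ k e t → msub k e t ≡ sb var idR (onlyAt k e) t
msub≡sb k e t = sym (sb≡msub ≗-refl ≗-refl ≗-refl t)

sb-single-wkλ : ∀ w t → sb (single w) idR ∅ (wkλ t) ≡ t
sb-single-wkλ w t = trans (sb∘ren {s' = var} {ν' = idR} {κ' = ∅} ≗-refl ≗-refl ≗-refl t) (sb-id t)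

sbE-single-wkλ : ∀ w e → sbE (single w) idR ∅ (wkλE e) ≡ e
sbE-single-wkλ w e =
  trans (sbE∘renE {s' = var} {ν' = idR} {κ' = ∅} ≗-refl ≗-refl ≗-refl e) (sbE-id e)

sbS-single-wkλ : ∀ w S → sbS (single w) idR ∅ (wkλS S) ≡ S
sbS-single-wkλ w S = trans (sym (map-∘ S)) (trans (map-cong (sbE-single-wkλ w) S) (map-id S))

subE-single-wkλ : ∀ w e → subE (single w) (wkλE e) ≡ e
subE-single-wkλ w e =
  trans (sym (sbE≡subE ≗-refl ≗-refl ≗-refl (wkλE e))) (sbE-single-wkλ w e)

sb-exts-[0≔] : ∀ w s ν κ u → sb (exts s) ν (wkλS ∘ κ) u [0≔ w ] ≡ sb (w ▸ s) ν κ u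
sb-exts-[0≔] w s ν κ u =
  trans (sub≡sb (single w) (sb (exts s) ν (wkλS ∘ κ) u))
        (sb∘sb {s₁ = single w} {ν₁ = idR} {κ₁ = ∅} {s₂ = exts s} {ν₂ = ν} {κ₂ = wkλS ∘ κ} hs ≗-refl hκ u)
  where
  hs : sb (single w) idR ∅ ∘ exts s ≗ w ▸ s
  hs zero    = refl
  hs (suc n) = sb-single-wkλ w (s n)
  hκ : ∀ a → sbS (single w) idR ∅ (wkλS (κ a)) ++ [] ≡ κ a
  hκ a = trans (++-identityʳ _) (sbS-single-wkλ w (κ a))

sb-[0≔] : ∀ s ν κ u v → sb s ν κ (u [0≔ v ]) ≡ sb (sb s ν κ v ▸ s) ν κ u
sb-[0≔] s ν κ u v = trans (cong (sb s ν κ) (sub≡sb (single v) u))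
  (sb∘sb {s₂ = single v} {ν₂ = idR} {κ₂ = ∅} (λ { zero → refl ; (suc n) → refl }) ≗-refl ≗-refl u)

sb-exts-[0≔]-sb : ∀ s ν κ u v → sb (exts s) ν (wkλS ∘ κ) u [0≔ sb s ν κ v ] ≡ sb s ν κ (u [0≔ v ])
sb-exts-[0≔]-sb s ν κ u v = trans (sb-exts-[0≔] (sb s ν κ v) s ν κ u) (sym (sb-[0≔] s ν κ u v))

sb-var-wkμ : ∀ κ → κ ∘ suc ≗ ∅ → ∀ t → sb var idR κ (wkμ t) ≡ wkμ t
sb-var-wkμ κ hκ t = trans (sb∘ren {s' = var} {ν' = suc} {κ' = ∅} ≗-refl ≗-refl hκ t)
                          (sb≡ren ≗-refl ≗-refl ≗-refl t)

sbE-var-wkμ : ∀ κ → κ ∘ suc ≗ ∅ → ∀ e → sbE var idR κ (wkμE e) ≡ wkμE e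
sbE-var-wkμ κ hκ e = trans (sbE∘renE {s' = var} {ν' = suc} {κ' = ∅} ≗-refl ≗-refl hκ e)
                           (sbE≡renE ≗-refl ≗-refl ≗-refl e)

sbS-var-wkμ : ∀ κ → κ ∘ suc ≗ ∅ → ∀ S → sbS var idR κ (wkμS S) ≡ wkμS S
sbS-var-wkμ κ hκ S = trans (sym (map-∘ S)) (map-cong (sbE-var-wkμ κ hκ) S)

sb-msub : ∀ s ν κ t e →
          msub zero (wkμE (sbE s ν κ e)) (sb (wkμ ∘ s) (ext ν) (extκ κ) t)
          ≡ sb (wkμ ∘ s) (ext ν) (extκ κ) (msub zero (wkμE e) t)
sb-msub s ν κ t e = trans msub-after-sb (sym sb-after-msub)
  where
  e' = wkμE (sbE s ν κ e)
  κ⁺ : ℕ → Stack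
  κ⁺ = (e' ∷ []) ▸ (wkμS ∘ κ)

  msub-after-sb : msub zero e' (sb (wkμ ∘ s) (ext ν) (extκ κ) t) ≡ sb (wkμ ∘ s) (ext ν) κ⁺ t
  msub-after-sb = trans (msub≡sb zero e' (sb (wkμ ∘ s) (ext ν) (extκ κ) t))
    (sb∘sb {s₁ = var} {ν₁ = idR} {κ₁ = onlyAt zero e'} {s₂ = wkμ ∘ s} {ν₂ = ext ν} {κ₂ = extκ κ}
      (λ n → sb-var-wkμ _ ≗-refl (s n)) ≗-refl
      (λ { zero    → refl
         ; (suc a) → trans (cong (_++ []) (sbS-var-wkμ _ ≗-refl (κ a))) (++-identityʳ _) }) t)

  sb-after-msub : sb (wkμ ∘ s) (ext ν) (extκ κ) (msub zero (wkμE e) t) ≡ sb (wkμ ∘ s) (ext ν) κ⁺ t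
  sb-after-msub = trans (cong (sb (wkμ ∘ s) (ext ν) (extκ κ)) (msub≡sb zero (wkμE e) t))
    (sb∘sb {s₁ = wkμ ∘ s} {ν₁ = ext ν} {κ₁ = extκ κ} {s₂ = var} {ν₂ = idR} {κ₂ = onlyAt zero (wkμE e)}
      ≗-refl ≗-refl (λ { zero → cong (_∷ []) (sbE-wkμ s ν κ e) ; (suc a) → refl }) t)

-- Reduction

plug-▷ : ∀ {t t'} S → t ▷ t' → plug t S ▷ plug t' S
plug-▷ []      p = p
plug-▷ (e ∷ S) p = plug-▷ S (c-appl p)

mutual
  sb-▷ : ∀ s ν κ {t t'} → t ▷ t' → sb s ν κ t ▷ sb s ν κ t'
  sb-▷ s ν κ (β {u} {v})        = respʳ _▷_ (sb-exts-[0≔]-sb s ν κ u v) β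
  sb-▷ s ν κ β∧₁                = β∧₁
  sb-▷ s ν κ β∧₂                = β∧₂
  sb-▷ s ν κ (β∨₁ {t} {u₁})      = respʳ _▷_ (sb-exts-[0≔]-sb s ν κ u₁ t) β∨₁
  sb-▷ s ν κ (β∨₂ {t} {u₁} {u₂}) = respʳ _▷_ (sb-exts-[0≔]-sb s ν κ u₂ t) β∨₂
  sb-▷ s ν κ (μβ {t} {e})        = respʳ _▷_ (cong mu (sb-msub s ν κ t e)) μβ
  sb-▷ s ν κ (perm {t} {u₁} {u₂} {e}) =
    respʳ _▷_ (cong (λ e' → app (sb s ν κ t) (case (app u₁' e') (app u₂' e'))) (sym (sbE-wkλ s ν κ e)))
      perm
    where u₁' = sb (exts s) ν (wkλS ∘ κ) u₁
          u₂' = sb (exts s) ν (wkλS ∘ κ) u₂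
  sb-▷ s ν κ (c-lam p)    = c-lam (sb-▷ _ _ _ p)
  sb-▷ s ν κ (c-appl p)   = c-appl (sb-▷ _ _ _ p)
  sb-▷ s ν κ (c-appr p)   = c-appr (sbE-▷ _ _ _ p)
  sb-▷ s ν κ (c-pairl p)  = c-pairl (sb-▷ _ _ _ p)
  sb-▷ s ν κ (c-pairr p)  = c-pairr (sb-▷ _ _ _ p)
  sb-▷ s ν κ (c-ω₁ p)     = c-ω₁ (sb-▷ _ _ _ p)
  sb-▷ s ν κ (c-ω₂ p)     = c-ω₂ (sb-▷ _ _ _ p)
  sb-▷ s ν κ (c-mu p)     = c-mu (sb-▷ _ _ _ p)
  sb-▷ s ν κ (c-nm {a} p) = c-nm (plug-▷ (κ a) (sb-▷ _ _ _ p))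

  sbE-▷ : ∀ s ν κ {e e'} → e ▷E e' → sbE s ν κ e ▷E sbE s ν κ e'
  sbE-▷ s ν κ (c-tm p)    = c-tm (sb-▷ _ _ _ p)
  sbE-▷ s ν κ (c-casel p) = c-casel (sb-▷ _ _ _ p)
  sbE-▷ s ν κ (c-caser p) = c-caser (sb-▷ _ _ _ p)

ren-▷ : ∀ ρ σ {t t'} → t ▷ t' → ren ρ σ t ▷ ren ρ σ t'
ren-▷ ρ σ {t} {t'} p =
  subst₂ _▷_ (sb≡ren ≗-refl ≗-refl ≗-refl t) (sb≡ren ≗-refl ≗-refl ≗-refl t')
         (sb-▷ (var ∘ ρ) σ ∅ p)

renE-▷ : ∀ ρ σ {e e'} → e ▷E e' → renE ρ σ e ▷E renE ρ σ e'
renE-▷ ρ σ {e} {e'} p =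
  subst₂ _▷E_ (sbE≡renE ≗-refl ≗-refl ≗-refl e) (sbE≡renE ≗-refl ≗-refl ≗-refl e')
         (sbE-▷ (var ∘ ρ) σ ∅ p)

[0≔]-▷ : ∀ {u u'} w → u ▷ u' → u [0≔ w ] ▷ u' [0≔ w ]
[0≔]-▷ {u} {u'} w p =
  subst₂ _▷_ (sym (sub≡sb (single w) u)) (sym (sub≡sb (single w) u')) (sb-▷ (single w) idR ∅ p)

SN : Term → Set
SN = Acc (flip _▷_)

SN-▷ : ∀ {t t'} → SN t → t ▷ t' → SN t'
SN-▷ (acc snt) p = snt p

infix 4 _▷*_
_▷*_ : Term → Term → Set
_▷*_ = Star _▷_

SN-▷* : ∀ {t t'} → SN t → t ▷* t' → SN t'
SN-▷* snt ε       = snt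
SN-▷* snt (p ◅ q) = SN-▷* (SN-▷ snt p) q

SN-reflect : ∀ (f : Term → Term) → (∀ {t t'} → t ▷ t' → f t ▷ f t') →
             ∀ {t} → SN (f t) → SN t
SN-reflect f f-▷ (acc snft) = acc (λ p → SN-reflect f f-▷ (snft (f-▷ p)))

SN-plug⁻ : ∀ S {t} → SN (plug t S) → SN t
SN-plug⁻ S = SN-reflect (flip plug S) (plug-▷ S)

-- Reductions of plug h S taking place inside S; perm-▷ permutes a case with the next entry.
infix 4 _▷ˢ_
data _▷ˢ_ : Stack → Stack → Set where
  head-▷ : ∀ {e e' S} → e ▷E e' → e ∷ S ▷ˢ e' ∷ S
  tail-▷ : ∀ {e S S'} → S ▷ˢ S' → e ∷ S ▷ˢ e ∷ S'
  perm-▷ : ∀ {u v e S} → case u v ∷ e ∷ S ▷ˢ case (app u (wkλE e)) (app v (wkλE e)) ∷ S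

SNˢ : Stack → Set
SNˢ = Acc (flip _▷ˢ_)

SNˢ-tail : ∀ {e S} → SNˢ (e ∷ S) → SNˢ S
SNˢ-tail (acc snS) = acc (λ p → SNˢ-tail (snS (tail-▷ p)))

plug-▷ˢ : ∀ t {S S'} → S ▷ˢ S' → plug t S ▷ plug t S'
plug-▷ˢ t (head-▷ {S = S} p) = plug-▷ S (c-appr p)
plug-▷ˢ t (tail-▷ {e} p)     = plug-▷ˢ (app t e) p
plug-▷ˢ t (perm-▷ {S = S})   = plug-▷ S perm

renS-▷ˢ : ∀ ρ σ {S S'} → S ▷ˢ S' → renS ρ σ S ▷ˢ renS ρ σ S'
renS-▷ˢ ρ σ (head-▷ p) = head-▷ (renE-▷ ρ σ p)
renS-▷ˢ ρ σ (tail-▷ p) = tail-▷ (renS-▷ˢ ρ σ p)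
renS-▷ˢ ρ σ (perm-▷ {u} {v} {e} {S}) =
  respʳ _▷ˢ_ (cong (λ e' → case (app u' e') (app v' e') ∷ renS ρ σ S) (sym (renE-wkλ ρ σ e))) perm-▷
  where u' = ren (ext ρ) σ u
        v' = ren (ext ρ) σ v

length-▷ˢ : ∀ {S S'} → S ▷ˢ S' → length S' ≤ length S
length-▷ˢ (head-▷ p) = ≤-refl
length-▷ˢ (tail-▷ p) = s≤s (length-▷ˢ p)
length-▷ˢ perm-▷     = s≤s (n≤1+n _)

mutual
  sb-▷* : (∀ n → s n ▷* s' n) → (∀ a → Star _▷ˢ_ (κ a) (κ' a)) →
          ∀ t → sb s ν κ t ▷* sb s' ν κ' t
  sb-▷* hs hκ (var x) = hs x
  sb-▷* hs hκ (lam t) = gmap lam c-lam (sb-▷* (exts-▷* hs) (wkλS-▷ˢ* hκ) t)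
  sb-▷* {s = s} {s' = s'} {κ = κ} {κ' = κ'} {ν = ν} hs hκ (app t e) =
    gmap (flip app (sbE s ν κ e)) c-appl (sb-▷* hs hκ t)
    ◅◅ gmap (app (sb s' ν κ' t)) c-appr (sbE-▷* hs hκ e)
  sb-▷* {s = s} {s' = s'} {κ = κ} {κ' = κ'} {ν = ν} hs hκ (pair t u) =
    gmap (flip pair (sb s ν κ u)) c-pairl (sb-▷* hs hκ t)
    ◅◅ gmap (pair (sb s' ν κ' t)) c-pairr (sb-▷* hs hκ u)
  sb-▷* hs hκ (ω₁ t) = gmap ω₁ c-ω₁ (sb-▷* hs hκ t)
  sb-▷* hs hκ (ω₂ t) = gmap ω₂ c-ω₂ (sb-▷* hs hκ t)
  sb-▷* hs hκ (mu t) =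
    gmap mu c-mu (sb-▷* (λ n → gmap wkμ (ren-▷ idR suc) (hs n)) (extκ-▷ˢ* hκ) t)
  sb-▷* {s = s} {s' = s'} {κ = κ} {κ' = κ'} {ν = ν} hs hκ (nm a t) =
    gmap (λ t' → nm (ν a) (plug t' (κ a))) (c-nm ∘ plug-▷ (κ a)) (sb-▷* hs hκ t)
    ◅◅ gmap (nm (ν a)) c-nm (gmap (plug (sb s' ν κ' t)) (plug-▷ˢ (sb s' ν κ' t)) (hκ a))

  sbE-▷* : (∀ n → s n ▷* s' n) → (∀ a → Star _▷ˢ_ (κ a) (κ' a)) →
           ∀ e → Star _▷E_ (sbE s ν κ e) (sbE s' ν κ' e)
  sbE-▷* hs hκ (tm t) = gmap tm c-tm (sb-▷* hs hκ t)
  sbE-▷* hs hκ π₁     = ε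
  sbE-▷* hs hκ π₂     = ε
  sbE-▷* {s = s} {s' = s'} {κ = κ} {κ' = κ'} {ν = ν} hs hκ (case u v) =
    gmap (flip case (sb (exts s) ν (wkλS ∘ κ) v)) c-casel (sb-▷* (exts-▷* hs) (wkλS-▷ˢ* hκ) u)
    ◅◅ gmap (case (sb (exts s') ν (wkλS ∘ κ') u)) c-caser (sb-▷* (exts-▷* hs) (wkλS-▷ˢ* hκ) v)

  exts-▷* : (∀ n → s n ▷* s' n) → ∀ n → exts s n ▷* exts s' n
  exts-▷* hs zero    = ε
  exts-▷* hs (suc n) = gmap wkλ (ren-▷ suc idR) (hs n)

  wkλS-▷ˢ* : (∀ a → Star _▷ˢ_ (κ a) (κ' a)) →
             ∀ a → Star _▷ˢ_ (wkλS (κ a)) (wkλS (κ' a))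
  wkλS-▷ˢ* hκ a = gmap wkλS (renS-▷ˢ suc idR) (hκ a)

  extκ-▷ˢ* : (∀ a → Star _▷ˢ_ (κ a) (κ' a)) →
             ∀ a → Star _▷ˢ_ (extκ κ a) (extκ κ' a)
  extκ-▷ˢ* hκ zero    = ε
  extκ-▷ˢ* hκ (suc a) = gmap wkμS (renS-▷ˢ idR suc) (hκ a)

[0≔]-▷* : ∀ u {w w'} → w ▷ w' → u [0≔ w ] ▷* u [0≔ w' ]
[0≔]-▷* u {w} {w'} p = subst₂ _▷*_ (sym (sub≡sb (single w) u)) (sym (sub≡sb (single w') u))
  (sb-▷* {ν = idR} (λ { zero → p ◅ ε ; (suc n) → ε }) (λ _ → ε) u)

plug-▷* : ∀ {t t'} S → t ▷* t' → plug t S ▷* plug t' S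
plug-▷* S = gmap (flip plug S) (plug-▷ S)

data Contraction : Term → Term → Set where
  β    : ∀ {u v} → Contraction (app (lam u) (tm v)) (u [0≔ v ])
  β∧₁  : ∀ {t₁ t₂} → Contraction (app (pair t₁ t₂) π₁) t₁
  β∧₂  : ∀ {t₁ t₂} → Contraction (app (pair t₁ t₂) π₂) t₂
  β∨₁  : ∀ {t u₁ u₂} → Contraction (app (ω₁ t) (case u₁ u₂)) (u₁ [0≔ t ])
  β∨₂  : ∀ {t u₁ u₂} → Contraction (app (ω₂ t) (case u₁ u₂)) (u₂ [0≔ t ])
  perm : ∀ {t u₁ u₂ e} →
         Contraction (app (app t (case u₁ u₂)) e) (app t (case (app u₁ (wkλE e)) (app u₂ (wkλE e))))
  μβ   : ∀ {t e} → Contraction (app (mu t) e) (mu (msub zero (wkμE e) t))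

data PlugStep (h : Term) : Stack → Term → Set where
  in-head  : ∀ {h' S} → h ▷ h' → PlugStep h S (plug h' S)
  in-stack : ∀ {S S'} → S ▷ˢ S' → PlugStep h S (plug h S')
  at-head  : ∀ {e S r} → Contraction (app h e) r → PlugStep h (e ∷ S) (plug r S)

private
  app-▷-inv : ∀ {h e S r} → app h e ▷ r → PlugStep h (e ∷ S) (plug r S)
  app-▷-inv β          = at-head β
  app-▷-inv β∧₁        = at-head β∧₁
  app-▷-inv β∧₂        = at-head β∧₂
  app-▷-inv β∨₁        = at-head β∨₁
  app-▷-inv β∨₂        = at-head β∨₂
  app-▷-inv perm       = at-head perm
  app-▷-inv μβ         = at-head μβ
  app-▷-inv (c-appl p) = in-head p
  app-▷-inv (c-appr p) = in-stack (head-▷ p)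

  PlugStep-app : ∀ {h e S r} → PlugStep (app h e) S r → PlugStep h (e ∷ S) r
  PlugStep-app (in-head p)    = app-▷-inv p
  PlugStep-app (in-stack p)   = in-stack (tail-▷ p)
  PlugStep-app (at-head perm) = in-stack perm-▷

plug-▷-inv : ∀ h S {r} → plug h S ▷ r → PlugStep h S r
plug-▷-inv h []      p = in-head p
plug-▷-inv h (e ∷ S) p = PlugStep-app (plug-▷-inv (app h e) S p)

-- Expansion lemmas

SN-var-plug : ∀ x S → SNˢ S → SN (plug (var x) S)
SN-var-plug x S (acc snS) = acc (λ p → step (plug-▷-inv (var x) S p))
  where
  step : ∀ {r} → PlugStep (var x) S r → SN r
  step (in-head ())
  step (in-stack p) = SN-var-plug x _ (snS p)
  step (at-head ())

SN-nm : ∀ {a t} → SN t → SN (nm a t)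
SN-nm (acc snt) = acc λ { (c-nm p) → SN-nm (snt p) }

β-expand : ∀ u w S → SN w → SN (plug (u [0≔ w ]) S) → SN (plug (lam u) (tm w ∷ S))
β-expand u w S snw snr = acc (λ p → step snw snr (plug-▷-inv (lam u) (tm w ∷ S) p))
  where
  step : ∀ {r} → SN w → SN (plug (u [0≔ w ]) S) → PlugStep (lam u) (tm w ∷ S) r → SN r
  step snw (acc snr) (in-head (c-lam {t' = u'} p)) =
    β-expand u' w S snw (snr (plug-▷ S ([0≔]-▷ w p)))
  step (acc snw) snr (in-stack (head-▷ (c-tm {t' = w'} p))) =
    β-expand u w' S (snw p) (SN-▷* snr (plug-▷* S ([0≔]-▷* u p)))
  step snw (acc snr) (in-stack (tail-▷ {S' = S'} p)) =
    β-expand u w S' snw (snr (plug-▷ˢ (u [0≔ w ]) p))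
  step snw snr (at-head β) = snr

π₁-expand : ∀ t u S → SN u → SN (plug t S) → SN (plug (pair t u) (π₁ ∷ S))
π₁-expand t u S snu snr = acc (λ p → step snu snr (plug-▷-inv (pair t u) (π₁ ∷ S) p))
  where
  step : ∀ {r} → SN u → SN (plug t S) → PlugStep (pair t u) (π₁ ∷ S) r → SN r
  step snu (acc snr) (in-head (c-pairl {t' = t'} p)) = π₁-expand t' u S snu (snr (plug-▷ S p))
  step (acc snu) snr (in-head (c-pairr {u' = u'} p)) = π₁-expand t u' S (snu p) snr
  step snu snr (in-stack (head-▷ ()))
  step snu (acc snr) (in-stack (tail-▷ {S' = S'} p)) = π₁-expand t u S' snu (snr (plug-▷ˢ t p))
  step snu snr (at-head β∧₁) = snr

π₂-expand : ∀ t u S → SN t → SN (plug u S) → SN (plug (pair t u) (π₂ ∷ S))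
π₂-expand t u S snt snr = acc (λ p → step snt snr (plug-▷-inv (pair t u) (π₂ ∷ S) p))
  where
  step : ∀ {r} → SN t → SN (plug u S) → PlugStep (pair t u) (π₂ ∷ S) r → SN r
  step (acc snt) snr (in-head (c-pairl {t' = t'} p)) = π₂-expand t' u S (snt p) snr
  step snt (acc snr) (in-head (c-pairr {u' = u'} p)) = π₂-expand t u' S snt (snr (plug-▷ S p))
  step snt snr (in-stack (head-▷ ()))
  step snt (acc snr) (in-stack (tail-▷ {S' = S'} p)) = π₂-expand t u S' snt (snr (plug-▷ˢ u p))
  step snt snr (at-head β∧₂) = snr

-- In the next four lemmas a permutative or μ-step shortens the stack without decreasing any
-- strong normalisation hypothesis; the bound n on the length of the stack makes them terminate.

mutual
  ω₁-expand : ∀ n t u v S → length S ≤ n →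
              SN t → SN (plug (u [0≔ t ]) S) → SN (plug v (wkλS S)) → SN (plug (ω₁ t) (case u v ∷ S))
  ω₁-expand n t u v S ≤n snt snu snv =
    acc (λ p → ω₁-expand-step n ≤n snt snu snv (plug-▷-inv (ω₁ t) (case u v ∷ S) p))

  ω₁-expand-step : ∀ n {t u v S r} → length S ≤ n →
                   SN t → SN (plug (u [0≔ t ]) S) → SN (plug v (wkλS S)) →
                   PlugStep (ω₁ t) (case u v ∷ S) r → SN r
  ω₁-expand-step n {u = u} {v} {S} ≤n (acc snt) snu snv (in-head (c-ω₁ {t' = t'} p)) =
    ω₁-expand n t' u v S ≤n (snt p) (SN-▷* snu (plug-▷* S ([0≔]-▷* u p))) snv
  ω₁-expand-step n {t} {v = v} {S} ≤n snt (acc snu) snv (in-stack (head-▷ (c-casel {u' = u'} p))) =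
    ω₁-expand n t u' v S ≤n snt (snu (plug-▷ S ([0≔]-▷ t p))) snv
  ω₁-expand-step n {t} {u} {S = S} ≤n snt snu (acc snv) (in-stack (head-▷ (c-caser {v' = v'} p))) =
    ω₁-expand n t u v' S ≤n snt snu (snv (plug-▷ (wkλS S) p))
  ω₁-expand-step n {t} {u} {v} ≤n snt (acc snu) snv (in-stack (tail-▷ {S' = S'} p)) =
    ω₁-expand n t u v S' (≤-trans (length-▷ˢ p) ≤n) snt
      (snu (plug-▷ˢ (u [0≔ t ]) p)) (SN-▷ snv (plug-▷ˢ v (renS-▷ˢ suc idR p)))
  ω₁-expand-step (suc n) {t} {u} {v} {e ∷ S} (s≤s ≤n) snt snu snv (in-stack perm-▷) =
    ω₁-expand n t (app u (wkλE e)) (app v (wkλE e)) S ≤n snt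
      (subst (λ e' → SN (plug (app (u [0≔ t ]) e') S)) (sym (subE-single-wkλ t e)) snu) snv
  ω₁-expand-step n ≤n snt snu snv (at-head β∨₁) = snu

mutual
  ω₂-expand : ∀ n t u v S → length S ≤ n →
              SN t → SN (plug u (wkλS S)) → SN (plug (v [0≔ t ]) S) → SN (plug (ω₂ t) (case u v ∷ S))
  ω₂-expand n t u v S ≤n snt snu snv =
    acc (λ p → ω₂-expand-step n ≤n snt snu snv (plug-▷-inv (ω₂ t) (case u v ∷ S) p))

  ω₂-expand-step : ∀ n {t u v S r} → length S ≤ n →
                   SN t → SN (plug u (wkλS S)) → SN (plug (v [0≔ t ]) S) →
                   PlugStep (ω₂ t) (case u v ∷ S) r → SN r
  ω₂-expand-step n {u = u} {v} {S} ≤n (acc snt) snu snv (in-head (c-ω₂ {t' = t'} p)) =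
    ω₂-expand n t' u v S ≤n (snt p) snu (SN-▷* snv (plug-▷* S ([0≔]-▷* v p)))
  ω₂-expand-step n {t} {v = v} {S} ≤n snt (acc snu) snv (in-stack (head-▷ (c-casel {u' = u'} p))) =
    ω₂-expand n t u' v S ≤n snt (snu (plug-▷ (wkλS S) p)) snv
  ω₂-expand-step n {t} {u} {S = S} ≤n snt snu (acc snv) (in-stack (head-▷ (c-caser {v' = v'} p))) =
    ω₂-expand n t u v' S ≤n snt snu (snv (plug-▷ S ([0≔]-▷ t p)))
  ω₂-expand-step n {t} {u} {v} ≤n snt snu (acc snv) (in-stack (tail-▷ {S' = S'} p)) =
    ω₂-expand n t u v S' (≤-trans (length-▷ˢ p) ≤n) snt
      (SN-▷ snu (plug-▷ˢ u (renS-▷ˢ suc idR p))) (snv (plug-▷ˢ (v [0≔ t ]) p))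
  ω₂-expand-step (suc n) {t} {u} {v} {e ∷ S} (s≤s ≤n) snt snu snv (in-stack perm-▷) =
    ω₂-expand n t (app u (wkλE e)) (app v (wkλE e)) S ≤n snt snu
      (subst (λ e' → SN (plug (app (v [0≔ t ]) e') S)) (sym (subE-single-wkλ t e)) snv)
  ω₂-expand-step n ≤n snt snu snv (at-head β∨₂) = snv

-- sb var idR (κ₀ S) t is t with the whole stack S passed to every (0 v), i.e. the result of
-- contracting (μ.t) S all at once.
κ₀ : Stack → ℕ → Stack
κ₀ S = wkμS S ▸ ∅

sb-κ₀-∷ : ∀ e S t → sb var idR (κ₀ (e ∷ S)) t ≡ sb var idR (κ₀ S) (msub zero (wkμE e) t)
sb-κ₀-∷ e S t = sym (trans (cong (sb var idR (κ₀ S)) (msub≡sb zero (wkμE e) t))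
  (sb∘sb {s₁ = var} {ν₁ = idR} {κ₁ = κ₀ S} {s₂ = var} {ν₂ = idR} {κ₂ = onlyAt zero (wkμE e)}
    ≗-refl ≗-refl (λ { zero → cong (_∷ wkμS S) (sbE-var-wkμ (κ₀ S) ≗-refl e) ; (suc a) → refl }) t))

mutual
  μ-expand : ∀ n t S → length S ≤ n → SNˢ S → SN (sb var idR (κ₀ S) t) → SN (plug (mu t) S)
  μ-expand n t S ≤n snS snt = acc (λ p → μ-expand-step n ≤n snS snt (plug-▷-inv (mu t) S p))

  μ-expand-step : ∀ n {t S r} → length S ≤ n → SNˢ S → SN (sb var idR (κ₀ S) t) →
                  PlugStep (mu t) S r → SN r
  μ-expand-step n {S = S} ≤n snS (acc snt) (in-head (c-mu {t' = t'} p)) =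
    μ-expand n t' S ≤n snS (snt (sb-▷ var idR (κ₀ S) p))
  μ-expand-step n {t} ≤n (acc snS) snt (in-stack {S' = S'} p) =
    μ-expand n t S' (≤-trans (length-▷ˢ p) ≤n) (snS p)
      (SN-▷* snt (sb-▷* {ν = idR} (λ _ → ε) (λ { zero → renS-▷ˢ idR suc p ◅ ε ; (suc a) → ε }) t))
  μ-expand-step (suc n) {t} {e ∷ S} (s≤s ≤n) snS snt (at-head μβ) =
    μ-expand n (msub zero (wkμE e) t) S ≤n (SNˢ-tail snS) (subst SN (sb-κ₀-∷ e S t) snt)

mutual
  SNˢ-case∷ : ∀ n u v S → length S ≤ n →
              SN (plug u (wkλS S)) → SN (plug v (wkλS S)) → SNˢ (case u v ∷ S)
  SNˢ-case∷ n u v S ≤n snu snv = acc (SNˢ-case∷-step n ≤n snu snv)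

  SNˢ-case∷-step : ∀ n {u v S S'} → length S ≤ n →
                   SN (plug u (wkλS S)) → SN (plug v (wkλS S)) → case u v ∷ S ▷ˢ S' → SNˢ S'
  SNˢ-case∷-step n {v = v} {S} ≤n (acc snu) snv (head-▷ (c-casel {u' = u'} p)) =
    SNˢ-case∷ n u' v S ≤n (snu (plug-▷ (wkλS S) p)) snv
  SNˢ-case∷-step n {u} {S = S} ≤n snu (acc snv) (head-▷ (c-caser {v' = v'} p)) =
    SNˢ-case∷ n u v' S ≤n snu (snv (plug-▷ (wkλS S) p))
  SNˢ-case∷-step n {u} {v} ≤n (acc snu) snv (tail-▷ {S' = S'} p) =
    SNˢ-case∷ n u v S' (≤-trans (length-▷ˢ p) ≤n)
      (snu (plug-▷ˢ u (renS-▷ˢ suc idR p))) (SN-▷ snv (plug-▷ˢ v (renS-▷ˢ suc idR p)))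
  SNˢ-case∷-step (suc n) {u} {v} {e ∷ S} (s≤s ≤n) snu snv perm-▷ =
    SNˢ-case∷ n (app u (wkλE e)) (app v (wkλE e)) S ≤n snu snv

SNˢ-tm∷ : ∀ {u S} → SN u → SNˢ S → SNˢ (tm u ∷ S)
SNˢ-tm∷ (acc snu) (acc snS) = acc λ
  { (head-▷ (c-tm p)) → SNˢ-tm∷ (snu p) (acc snS)
  ; (tail-▷ p)        → SNˢ-tm∷ (acc snu) (snS p) }

SNˢ-π₁∷ : ∀ {S} → SNˢ S → SNˢ (π₁ ∷ S)
SNˢ-π₁∷ (acc snS) = acc λ { (head-▷ ()) ; (tail-▷ p) → SNˢ-π₁∷ (snS p) }

SNˢ-π₂∷ : ∀ {S} → SNˢ S → SNˢ (π₂ ∷ S)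
SNˢ-π₂∷ (acc snS) = acc λ { (head-▷ ()) ; (tail-▷ p) → SNˢ-π₂∷ (snS p) }

-- Reducibility

-- Closing under renamings is what lets case branches and μ-bodies be weakened.
mutual
  Red : Ty → Term → Set
  Red A t = ∀ ρ σ S → RedStack A S → SN (plug (ren ρ σ t) S)

  RedBranch : Ty → Term → Stack → Set
  RedBranch A u S = ∀ ρ σ w → Red A w → SN (plug (ren (ext ρ) σ u [0≔ w ]) (renS ρ σ S))

  RedStack : Ty → Stack → Set
  RedStack (atom n) S = S ≡ []
  RedStack ⊥'       S = S ≡ []
  RedStack (A ⇒ B)  S = Σ Term λ u → Σ Stack λ S' → S ≡ tm u ∷ S' × Red A u × RedStack B S'
  RedStack (A ∧' B) S =
    Σ Stack λ S' → (S ≡ π₁ ∷ S' × RedStack A S') ⊎ (S ≡ π₂ ∷ S' × RedStack B S')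
  RedStack (A ∨' B) S =
    Σ Term λ u → Σ Term λ v → Σ Stack λ S' →
      S ≡ case u v ∷ S' × RedBranch A u S' × RedBranch B v S'

Red-ren : ∀ {A t} ρ σ → Red A t → Red A (ren ρ σ t)
Red-ren {t = t} ρ σ red ρ' σ' S rS =
  subst (λ t' → SN (plug t' S)) (sym (ren-∘ ≗-refl ≗-refl t)) (red (ρ' ∘ ρ) (σ' ∘ σ) S rS)

RedBranch-ren : ∀ {A u S} ρ σ → RedBranch A u S → RedBranch A (ren (ext ρ) σ u) (renS ρ σ S)
RedBranch-ren {u = u} {S} ρ σ red ρ' σ' w rw =
  subst SN (cong₂ (λ u' S' → plug (u' [0≔ w ]) S')
                  (sym (ren-∘ (ext-∘ ≗-refl) ≗-refl u))
                  (sym (renS-∘ ≗-refl ≗-refl S)))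
           (red (ρ' ∘ ρ) (σ' ∘ σ) w rw)

RedStack-ren : ∀ A ρ σ S → RedStack A S → RedStack A (renS ρ σ S)
RedStack-ren (atom n) ρ σ .[] refl = refl
RedStack-ren ⊥'       ρ σ .[] refl = refl
RedStack-ren (A ⇒ B)  ρ σ _ (u , S , refl , ru , rS) =
  ren ρ σ u , renS ρ σ S , refl , Red-ren ρ σ ru , RedStack-ren B ρ σ S rS
RedStack-ren (A ∧' B) ρ σ _ (S , inj₁ (refl , rS)) =
  renS ρ σ S , inj₁ (refl , RedStack-ren A ρ σ S rS)
RedStack-ren (A ∧' B) ρ σ _ (S , inj₂ (refl , rS)) =
  renS ρ σ S , inj₂ (refl , RedStack-ren B ρ σ S rS)
RedStack-ren (A ∨' B) ρ σ _ (u , v , S , refl , ru , rv) =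
  ren (ext ρ) σ u , ren (ext ρ) σ v , renS ρ σ S , refl ,
  RedBranch-ren {A} {u} {S} ρ σ ru , RedBranch-ren {B} {v} {S} ρ σ rv

RedBranch-id : ∀ {A u S} → RedBranch A u S → ∀ w → Red A w → SN (plug (u [0≔ w ]) S)
RedBranch-id {u = u} {S} red w rw =
  subst SN (cong₂ (λ u' S' → plug (u' [0≔ w ]) S')
                  (ren-id (ext-id ≗-refl) ≗-refl u)
                  (renS-id ≗-refl ≗-refl S))
           (red idR idR w rw)

RedBranch⇒SN : ∀ {A u S} → Red A (var zero) → RedBranch A u S → SN (plug u (wkλS S))
RedBranch⇒SN {A} {u} {S} r0 red =
  SN-reflect (_[0≔ var zero ]) ([0≔]-▷ (var zero))
    (subst SN eq (RedBranch-id {A} {u} {S} red (var zero) r0))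
  where
  eq : plug (u [0≔ var zero ]) S ≡ plug u (wkλS S) [0≔ var zero ]
  eq = sym (trans (sub≡sb (single (var zero)) (plug u (wkλS S)))
           (trans (sb-plug (single (var zero)) idR ∅ u (wkλS S))
                  (cong₂ plug (sym (sub≡sb (single (var zero)) u)) (sbS-single-wkλ (var zero) S))))

canonical : Ty → Stack
canonical (atom n) = []
canonical ⊥'       = []
canonical (A ⇒ B)  = tm (var zero) ∷ canonical B
canonical (A ∧' B) = π₁ ∷ canonical A
canonical (A ∨' B) = case (var zero) (var zero) ∷ []

mutual
  RedStack⇒SNˢ : ∀ A S → RedStack A S → SNˢ S
  RedStack⇒SNˢ (atom n) .[] refl = acc (λ ())
  RedStack⇒SNˢ ⊥'       .[] refl = acc (λ ())
  RedStack⇒SNˢ (A ⇒ B)  _ (u , S , refl , ru , rS) = SNˢ-tm∷ (Red⇒SN A u ru) (RedStack⇒SNˢ B S rS)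
  RedStack⇒SNˢ (A ∧' B) _ (S , inj₁ (refl , rS))   = SNˢ-π₁∷ (RedStack⇒SNˢ A S rS)
  RedStack⇒SNˢ (A ∧' B) _ (S , inj₂ (refl , rS))   = SNˢ-π₂∷ (RedStack⇒SNˢ B S rS)
  RedStack⇒SNˢ (A ∨' B) _ (u , v , S , refl , ru , rv) =
    SNˢ-case∷ (length S) u v S ≤-refl
      (RedBranch⇒SN {A} {u} {S} (var-Red A zero) ru) (RedBranch⇒SN {B} {v} {S} (var-Red B zero) rv)

  var-Red : ∀ A x → Red A (var x)
  var-Red A x ρ σ S rS = SN-var-plug (ρ x) S (RedStack⇒SNˢ A S rS)

  Red⇒SN : ∀ A t → Red A t → SN t
  Red⇒SN A t red =
    SN-plug⁻ (canonical A) (subst (λ t' → SN (plug t' (canonical A))) (ren-id ≗-refl ≗-refl t)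
                                  (red idR idR (canonical A) (canonical-red A)))

  canonical-red : ∀ A → RedStack A (canonical A)
  canonical-red (atom n) = refl
  canonical-red ⊥'       = refl
  canonical-red (A ⇒ B)  = var zero , canonical B , refl , var-Red A zero , canonical-red B
  canonical-red (A ∧' B) = canonical A , inj₁ (refl , canonical-red A)
  canonical-red (A ∨' B) =
    var zero , var zero , [] , refl , (λ _ _ w rw → Red⇒SN A w rw) , (λ _ _ w rw → Red⇒SN B w rw)

-- Adequacy

RedSubst : Ctx → (ℕ → Term) → Set
RedSubst Γ s = ∀ {x B} → Γ ∋ x ⦂ B → Red B (s x)

RedStacks : Ctx → (ℕ → Stack) → Set
RedStacks Δ κ = ∀ {a B} → Δ ∋ a ⦂ B → RedStack B (κ a)

RedSubst-∷ : ∀ {Γ A w} → Red A w → RedSubst Γ s → RedSubst (A ∷ Γ) (w ▸ s)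
RedSubst-∷ rw rs here      = rw
RedSubst-∷ rw rs (there p) = rs p

RedSubst-ren : ∀ {Γ} ρ σ → RedSubst Γ s → RedSubst Γ (ren ρ σ ∘ s)
RedSubst-ren ρ σ rs p = Red-ren ρ σ (rs p)

RedStacks-ren : ∀ {Δ} ρ σ → RedStacks Δ κ → RedStacks Δ (renS ρ σ ∘ κ)
RedStacks-ren ρ σ rκ p = RedStack-ren _ ρ σ _ (rκ p)

RedStacks-∷ : ∀ {Δ A S} → RedStack A S → RedStacks Δ κ → RedStacks (A ∷ Δ) (wkμS ∘ (S ▸ κ))
RedStacks-∷ {A = A} {S} rS rκ here = RedStack-ren A idR suc S rS
RedStacks-∷ rS rκ (there p)        = RedStack-ren _ idR suc _ (rκ p)

sb-κ₀-extκ : ∀ s ν κ S t →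
             sb (wkμ ∘ s) (ext ν) (wkμS ∘ (S ▸ κ)) t
             ≡ sb var idR (κ₀ S) (sb (wkμ ∘ s) (ext ν) (extκ κ) t)
sb-κ₀-extκ s ν κ S t =
  sym (sb∘sb {s₁ = var} {ν₁ = idR} {κ₁ = κ₀ S} {s₂ = wkμ ∘ s} {ν₂ = ext ν} {κ₂ = extκ κ}
    (λ n → sb-var-wkμ (κ₀ S) ≗-refl (s n)) ≗-refl
    (λ { zero → refl ; (suc a) → trans (++-identityʳ _) (sbS-var-wkμ (κ₀ S) ≗-refl (κ a)) }) t)

mutual
  adequacy : ∀ {Γ Δ t A} → Γ ⊢ t ⦂ A ⨾ Δ → ∀ s ν κ → RedSubst Γ s → RedStacks Δ κ →
             ∀ S → RedStack A S → SN (plug (sb s ν κ t) S)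
  adequacy (ax {x = x} p) s ν κ rs rκ S rS =
    subst (λ t → SN (plug t S)) (ren-id ≗-refl ≗-refl (s x)) (rs p idR idR S rS)
  adequacy (→i {t = u} {A} d) s ν κ rs rκ _ (w , S , refl , rw , rS) =
    β-expand (sb (exts s) ν (wkλS ∘ κ) u) w S (Red⇒SN A w rw)
      (subst (λ t → SN (plug t S)) (sym (sb-exts-[0≔] w s ν κ u))
        (adequacy d (w ▸ s) ν κ (RedSubst-∷ rw rs) rκ S rS))
  adequacy (→e {v = v} d₁ d₂) s ν κ rs rκ S rS =
    adequacy d₁ s ν κ rs rκ (tm (sb s ν κ v) ∷ S) (_ , S , refl , adequacy-Red d₂ s ν κ rs rκ , rS)
  adequacy (∧i {u = u} {v} {B = B} d₁ d₂) s ν κ rs rκ _ (S , inj₁ (refl , rS)) =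
    π₁-expand (sb s ν κ u) (sb s ν κ v) S
      (Red⇒SN B _ (adequacy-Red d₂ s ν κ rs rκ)) (adequacy d₁ s ν κ rs rκ S rS)
  adequacy (∧i {u = u} {v} {A} d₁ d₂) s ν κ rs rκ _ (S , inj₂ (refl , rS)) =
    π₂-expand (sb s ν κ u) (sb s ν κ v) S
      (Red⇒SN A _ (adequacy-Red d₁ s ν κ rs rκ)) (adequacy d₂ s ν κ rs rκ S rS)
  adequacy (∧e₁ d) s ν κ rs rκ S rS = adequacy d s ν κ rs rκ (π₁ ∷ S) (S , inj₁ (refl , rS))
  adequacy (∧e₂ d) s ν κ rs rκ S rS = adequacy d s ν κ rs rκ (π₂ ∷ S) (S , inj₂ (refl , rS))
  adequacy (∨i₁ {t = t} {A} {B} d) s ν κ rs rκ _ (u , v , S , refl , ru , rv) =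
    ω₁-expand (length S) (sb s ν κ t) u v S ≤-refl
      (Red⇒SN A _ rt) (RedBranch-id {A} {u} {S} ru _ rt) (RedBranch⇒SN {B} {v} {S} (var-Red B zero) rv)
    where rt = adequacy-Red d s ν κ rs rκ
  adequacy (∨i₂ {t = t} {A} {B} d) s ν κ rs rκ _ (u , v , S , refl , ru , rv) =
    ω₂-expand (length S) (sb s ν κ t) u v S ≤-refl
      (Red⇒SN B _ rt) (RedBranch⇒SN {A} {u} {S} (var-Red A zero) ru) (RedBranch-id {B} {v} {S} rv _ rt)
    where rt = adequacy-Red d s ν κ rs rκ
  adequacy (∨e d d₁ d₂) s ν κ rs rκ S rS =
    adequacy d s ν κ rs rκ (case _ _ ∷ S)
      (_ , _ , S , refl , adequacy-branch d₁ s ν κ rs rκ S rS , adequacy-branch d₂ s ν κ rs rκ S rS)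
  adequacy (absi {a = a} p d) s ν κ rs rκ .[] refl = SN-nm (adequacy d s ν κ rs rκ (κ a) (rκ p))
  adequacy (abse {t = t} {A} d) s ν κ rs rκ S rS =
    μ-expand (length S) (sb (wkμ ∘ s) (ext ν) (extκ κ) t) S ≤-refl (RedStack⇒SNˢ A S rS)
      (subst SN (sb-κ₀-extκ s ν κ S t)
        (adequacy d (wkμ ∘ s) (ext ν) (wkμS ∘ (S ▸ κ))
                    (RedSubst-ren idR suc rs) (RedStacks-∷ rS rκ) [] refl))

  adequacy-Red : ∀ {Γ Δ t A} → Γ ⊢ t ⦂ A ⨾ Δ → ∀ s ν κ → RedSubst Γ s → RedStacks Δ κ →
                 Red A (sb s ν κ t)
  adequacy-Red {t = t} d s ν κ rs rκ ρ σ S rS =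
    subst (λ t' → SN (plug t' S)) (sym (ren∘sb ≗-refl ≗-refl ≗-refl t))
      (adequacy d (ren ρ σ ∘ s) (σ ∘ ν) (renS ρ σ ∘ κ) (RedSubst-ren ρ σ rs) (RedStacks-ren ρ σ rκ) S rS)

  adequacy-branch : ∀ {Γ Δ x C D} → (D ∷ Γ) ⊢ x ⦂ C ⨾ Δ → ∀ s ν κ → RedSubst Γ s → RedStacks Δ κ →
                    ∀ S → RedStack C S → RedBranch D (sb (exts s) ν (wkλS ∘ κ) x) S
  adequacy-branch {x = x} {C} dx s ν κ rs rκ S rS ρ σ w rw =
    subst (λ t → SN (plug t (renS ρ σ S))) (sym renamed-branch)
      (adequacy dx (w ▸ (ren ρ σ ∘ s)) (σ ∘ ν) (renS ρ σ ∘ κ) (RedSubst-∷ rw (RedSubst-ren ρ σ rs))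
        (RedStacks-ren ρ σ rκ) (renS ρ σ S) (RedStack-ren C ρ σ S rS))
    where
    renamed-branch : ren (ext ρ) σ (sb (exts s) ν (wkλS ∘ κ) x) [0≔ w ]
                     ≡ sb (w ▸ (ren ρ σ ∘ s)) (σ ∘ ν) (renS ρ σ ∘ κ) x
    renamed-branch =
      trans (cong (_[0≔ w ]) (ren∘sb {s' = exts (ren ρ σ ∘ s)} {ν' = σ ∘ ν} {κ' = wkλS ∘ (renS ρ σ ∘ κ)}
                                (exts-ren∘ ≗-refl) ≗-refl (wkλS-renS∘ ≗-refl) x))
            (sb-exts-[0≔] w (ren ρ σ ∘ s) (σ ∘ ν) (renS ρ σ ∘ κ) x)

typeAt : Ctx → ℕ → Ty
typeAt []      _       = ⊥'
typeAt (A ∷ Δ) zero    = A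
typeAt (A ∷ Δ) (suc a) = typeAt Δ a

typeAt-∋ : ∀ {Δ a A} → Δ ∋ a ⦂ A → typeAt Δ a ≡ A
typeAt-∋ here      = refl
typeAt-∋ (there p) = typeAt-∋ p

-- Adequacy needs reducible stacks for the free μ-variables, so t is first instantiated with
-- canonical stacks and strong normalisation is then reflected back along that substitution.
typed⇒SN : ∀ {Γ Δ t A} → Γ ⊢ t ⦂ A ⨾ Δ → SN t
typed⇒SN {Δ = Δ} {A = A} d =
  SN-reflect (sb var idR κΔ) (sb-▷ var idR κΔ)
    (SN-plug⁻ (canonical A)
      (adequacy d var idR κΔ (λ {x} {B} _ → var-Red B x) rκΔ (canonical A) (canonical-red A)))
  where
  κΔ : ℕ → Stack
  κΔ = canonical ∘ typeAt Δ
  rκΔ : RedStacks Δ κΔ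
  rκΔ {a} p = subst (λ B → RedStack B (κΔ a)) (typeAt-∋ p) (canonical-red (typeAt Δ a))

acc⇒¬infiniteDescent : ∀ {A : Set} {_<_ : A → A → Set} {x} → Acc _<_ x →
                       ¬ (∃[ f ] InfiniteDescendingSequenceFrom _<_ f x)
acc⇒¬infiniteDescent {_<_ = _<_} =
  descent∧acc⇒unsatisfiable {P = λ x → ∃[ f ] InfiniteDescendingSequenceFrom _<_ f x}
    λ { (f , refl , desc) → f 1 , desc 0 , f ∘ suc , refl , desc ∘ suc }

mainTheorem1 : (Γ Δ : Ctx) (t : Term) (A : Ty) → Γ ⊢ t ⦂ A ⨾ Δ →
    ¬ (Σ (ℕ → Term) (λ f → (f zero ≡ t) × ((i : ℕ) → f i ▷ f (suc i))))
mainTheorem1 Γ Δ t A d = acc⇒¬infiniteDescent (typed⇒SN d)
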